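{- Let $G$ be a finite abelian group and $n$ an odd positive integer. For each $g \in G$ let $P_g = \{(g,x) : x \in \mathbb{Z}_n\} \subseteq G \times \mathbb{Z}_n$. Let $c$ be a coloring of $G \times \mathbb{Z}_n$ such that, for all $g \in G$, $|c(P_g)| \le |c(P_0)|$ and $|c(P_g) \setminus c(P_0)| \le 1$. Let $\alpha$ be a symbol not in $\bigcup_{g\in G} (c(P_g)\setminus c(P_0))$, and define the coloring $\overline{c}$ of $G$ by $\overline{c}(g) = \alpha$ if $c(P_g) \subseteq c(P_0)$, and otherwise $\overline{c}(g)$ is the unique element of $c(P_g) \setminus c(P_0)$. If $G$ contains a rainbow 3-AP under $\overline{c}$, then $G \times \mathbb{Z}_n$ contains a rainbow 3-AP under $c$.
   Context: $\mathbb{Z}_n$ is the cyclic group $\{0,\dots,n-1\}$ under addition mod $n$. A 3-term arithmetic progression (3-AP) in an abelian group $H$ is a sequence $a, a+d, a+2d$ with $a,d \in H$. A coloring of $H$ is a function from $H$ to a finite set of colors; for $P \subseteq H$, $c(P)=\{c(x):x\in P\}$. A 3-AP is rainbow under a coloring if its three terms receive three pairwise distinct colors. -}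

module Defs where

open import Level using (0ℓ)
open import Data.Nat using (ℕ; suc; _+_; _*_; NonZero)
open import Data.Nat.DivMod using (_%_; m%n<n)
open import Data.Fin using (Fin; toℕ; fromℕ<)
open import Data.List using (map; allFin)
open import Data.Product using (_×_; _,_; ∃₂)
open import Data.Fin.Subset using (Subset; ⋃; ⁅_⁆)
open import Relation.Binary.PropositionalEquality using (_≡_; _≢_)

ℤ+ : ∀ n → Fin n → Fin n → Fin n
ℤ+ (suc m) a b = fromℕ< (m%n<n (toℕ a + toℕ b) (suc m))

prodOp : {G : Set} → (G → G → G) → (n : ℕ) → G × Fin n → G × Fin n → G × Fin n
prodOp _∙_ n (g , x) (h , y) = (g ∙ h) , ℤ+ n x y

HasRainbow3AP : {H C : Set} → (H → H → H) → (H → C) → Set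
HasRainbow3AP {H} _⊕_ col =
  ∃₂ λ (a d : H) →
    let b = a ⊕ d
        e = (a ⊕ d) ⊕ d
    in (col a ≢ col b) × (col b ≢ col e) × (col a ≢ col e)

colorsOnFiber : {G : Set} {n k : ℕ} → (G × Fin n → Fin k) → G → Subset k
colorsOnFiber {n = n} c g = ⋃ (map (λ x → ⁅ c (g , x) ⁆) (allFin n))

-- At most one term of a rainbow progression of cbar has colour α; the other two,
-- over g and h, have new colours cbar g ≠ cbar h, and each is the colour of some
-- point of its fibre. A progression in ℤ_n through those two points at the right
-- indices exists (halving is needed when they are the two ends, hence n odd). Its
-- third point cannot repeat either colour: a fibre has at most one new colour, so a
-- point over h' coloured cbar g forces cbar h' = cbar g.
module Submission where

open import Defs
open import Data.Nat using (ℕ; suc; _+_; _*_; _≤_; _%_)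
open import Data.Nat.DivMod using (_mod_; m%n<n; %-distribˡ-+; [m+kn]%n≡m%n; m<n⇒m%n≡m)
open import Data.Nat.Properties using (+-comm; ≤-<-trans; <-≤-trans; <-irrefl)
open import Data.Nat.Tactic.RingSolver using (solve-∀)
open import Data.Fin using (Fin; toℕ; _≟_)
open import Data.Fin.Properties using (toℕ-injective; toℕ-fromℕ<; toℕ<n)
open import Data.Fin.Subset using (Subset; _⊆_; _─_; _∈_; _∉_; ∣_∣; ⋃)
open import Data.Fin.Subset.Properties
  using (x∈p∪q⁻; x∈p∪q⁺; ∉⊥; x∈⁅x⁆; x∈⁅y⁆⇒x≡y; ∣⁅x⁆∣≡1; p⊆q⇒∣p∣≤∣q∣; p─q⊆p;
         x∈p∧x∉q⇒x∈p─q; x∈p∧x≢y⇒x∈p-y; x∈p⇒∣p-x∣<∣p∣)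
open import Data.List using (List; []; _∷_; allFin)
open import Data.List.Relation.Unary.Any as Any using (Any; here; there; satisfied)
open import Data.List.Relation.Unary.Any.Properties using (map⁺; map⁻)
open import Data.List.Membership.Propositional.Properties using (∈-allFin)
import Data.Vec.Base as Vec
open import Data.Product using (_×_; _,_; Σ; ∃; ∃₂)
open import Data.Sum using (inj₁; inj₂)
open import Data.Empty using (⊥-elim)
open import Algebra.Structures using (IsAbelianGroup)
open import Function.Bundles using (_↔_)
open import Relation.Binary.PropositionalEquality
open import Relation.Nullary using (¬_; yes; no)

private
  variable
    n : ℕ
    p q : Subset n
    x y : Fin n

x∈p─q⇒x∉q : x ∈ p ─ q → x ∉ q
x∈p─q⇒x∉q {p = _ Vec.∷ _} {q = _ Vec.∷ _} (Vec.there x∈p─q) (Vec.there x∈q) = x∈p─q⇒x∉q x∈p─q x∈q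

x∈p⇒1≤∣p∣ : x ∈ p → 1 ≤ ∣ p ∣
x∈p⇒1≤∣p∣ {x = x} {p = p} x∈p = subst (_≤ ∣ p ∣) (∣⁅x⁆∣≡1 x)
  (p⊆q⇒∣p∣≤∣q∣ λ y∈⁅x⁆ → subst (_∈ p) (sym (x∈⁅y⁆⇒x≡y x y∈⁅x⁆)) x∈p)

∣p∣≤1∧x∈p∧y∈p⇒x≡y : ∣ p ∣ ≤ 1 → x ∈ p → y ∈ p → x ≡ y
∣p∣≤1∧x∈p∧y∈p⇒x≡y {x = x} {y = y} ∣p∣≤1 x∈p y∈p with x ≟ y
... | yes x≡y = x≡y
... | no  x≢y = ⊥-elim (<-irrefl refl
  (≤-<-trans (x∈p⇒1≤∣p∣ (x∈p∧x≢y⇒x∈p-y y∈p (≢-sym x≢y))) (<-≤-trans (x∈p⇒∣p-x∣<∣p∣ x∈p) ∣p∣≤1)))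

x∈⋃⁺ : {ps : List (Subset n)} → Any (x ∈_) ps → x ∈ ⋃ ps
x∈⋃⁺ (here x∈p)  = x∈p∪q⁺ (inj₁ x∈p)
x∈⋃⁺ (there x∈ps) = x∈p∪q⁺ (inj₂ (x∈⋃⁺ x∈ps))

x∈⋃⁻ : (ps : List (Subset n)) → x ∈ ⋃ ps → Any (x ∈_) ps
x∈⋃⁻ []       x∈⊥ = ⊥-elim (∉⊥ x∈⊥)
x∈⋃⁻ (p ∷ ps) x∈⋃ with x∈p∪q⁻ p (⋃ ps) x∈⋃
... | inj₁ x∈p  = here x∈p
... | inj₂ x∈ps = there (x∈⋃⁻ ps x∈ps)

module _ {G : Set} {k : ℕ} (c : G × Fin n → Fin k) where

  ∈-colorsOnFiber⁺ : ∀ g x → c (g , x) ∈ colorsOnFiber c g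
  ∈-colorsOnFiber⁺ g x =
    x∈⋃⁺ (map⁺ (Any.map (λ { refl → x∈⁅x⁆ (c (g , x)) }) (∈-allFin x)))

  ∈-colorsOnFiber⁻ : ∀ {g v} → v ∈ colorsOnFiber c g → ∃ λ x → c (g , x) ≡ v
  ∈-colorsOnFiber⁻ {g} v∈ with satisfied (map⁻ {xs = allFin n} (x∈⋃⁻ _ v∈))
  ... | x , v∈⁅cgx⁆ = x , sym (x∈⁅y⁆⇒x≡y _ v∈⁅cgx⁆)

module _ {m : ℕ} where

  private
    N : ℕ
    N = suc m

  infixl 6 _⊕_

  _⊕_ : Fin N → Fin N → Fin N
  _⊕_ = ℤ+ N

  mod-cong : ∀ a b → a % N ≡ b % N → a mod N ≡ b mod N
  mod-cong _ _ eq = toℕ-injective (trans (toℕ-fromℕ< _) (trans eq (sym (toℕ-fromℕ< _))))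

  toℕ-mod : (x : Fin N) → toℕ x mod N ≡ x
  toℕ-mod x = toℕ-injective (trans (toℕ-fromℕ< _) (m<n⇒m%n≡m (toℕ<n x)))

  mod-⊕-mod : ∀ a b → a mod N ⊕ b mod N ≡ (a + b) mod N
  mod-⊕-mod a b = mod-cong (toℕ (a mod N) + toℕ (b mod N)) (a + b) (begin
    (toℕ (a mod N) + toℕ (b mod N)) % N ≡⟨ cong₂ (λ u v → (u + v) % N) (toℕ-fromℕ< (m%n<n a N)) (toℕ-fromℕ< (m%n<n b N)) ⟩
    (a % N + b % N) % N                 ≡⟨ %-distribˡ-+ a b N ⟨
    (a + b) % N                         ∎)
    where open ≡-Reasoning

  [x+jN]modN≡x : ∀ (x : Fin N) j → (toℕ x + j * N) mod N ≡ x
  [x+jN]modN≡x x j = trans (mod-cong (toℕ x + j * N) (toℕ x) ([m+kn]%n≡m%n (toℕ x) j N)) (toℕ-mod x)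

  ⊕-comm : ∀ x y → x ⊕ y ≡ y ⊕ x
  ⊕-comm x y = cong (_mod N) (+-comm (toℕ x) (toℕ y))

  ⊕-solveʳ : ∀ x y → ∃ λ e → x ⊕ e ≡ y
  ⊕-solveʳ x y = e , (begin
    x ⊕ e                   ≡⟨ cong (_⊕ e) (toℕ-mod x) ⟨
    X mod N ⊕ e             ≡⟨ mod-⊕-mod X (Y + m * X) ⟩
    (X + (Y + m * X)) mod N ≡⟨ cong (_mod N) (cancel m X Y) ⟩
    (Y + X * N) mod N       ≡⟨ [x+jN]modN≡x y X ⟩
    y                       ∎)
    where
    open ≡-Reasoning
    X = toℕ x
    Y = toℕ y
    -- m * X stands for -X, as X + m * X = X * N.
    e = (Y + m * X) mod N
    cancel : ∀ m X Y → X + (Y + m * X) ≡ Y + X * suc m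
    cancel = solve-∀

  ap-with-last-two : ∀ y z → ∃₂ λ a e → a ⊕ e ≡ y × a ⊕ e ⊕ e ≡ z
  ap-with-last-two y z with ⊕-solveʳ y z
  ... | e , y⊕e≡z with ⊕-solveʳ e y
  ...   | a , e⊕a≡y = a , e , a⊕e≡y , trans (cong (_⊕ e) a⊕e≡y) y⊕e≡z
    where
    a⊕e≡y : a ⊕ e ≡ y
    a⊕e≡y = trans (⊕-comm a e) e⊕a≡y

  ap-with-ends : ∀ s → s + s ≡ suc N → ∀ x z → ∃ λ e → x ⊕ e ⊕ e ≡ z
  ap-with-ends s s+s≡1+N x z = e , (begin
    x ⊕ e ⊕ e                 ≡⟨ cong (λ u → u ⊕ e ⊕ e) (toℕ-mod x) ⟨
    X mod N ⊕ e ⊕ e           ≡⟨ cong (_⊕ e) (mod-⊕-mod X (s * D)) ⟩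
    (X + s * D) mod N ⊕ e     ≡⟨ mod-⊕-mod (X + s * D) (s * D) ⟩
    (X + s * D + s * D) mod N ≡⟨ cong (_mod N) (begin
      X + s * D + s * D         ≡⟨ double X s D ⟩
      X + (s + s) * D           ≡⟨ cong (λ w → X + w * D) s+s≡1+N ⟩
      X + suc N * D             ≡⟨ cancel m X Z ⟩
      Z + (X + D) * N           ∎) ⟩
    (Z + (X + D) * N) mod N   ≡⟨ [x+jN]modN≡x z (X + D) ⟩
    z                         ∎)
    where
    open ≡-Reasoning
    X = toℕ x
    Z = toℕ z
    -- s is the inverse of 2 in ℤ_N, so e = (Z - X) / 2.
    D = Z + m * X
    e = (s * D) mod N
    double : ∀ X s D → X + s * D + s * D ≡ X + (s + s) * D
    double = solve-∀
    cancel : ∀ m X Z → X + suc (suc m) * (Z + m * X) ≡ Z + (X + (Z + m * X)) * suc m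
    cancel = solve-∀

Rainbow : {H C : Set} → (H → C) → H → H → H → Set
Rainbow col x y z = col x ≢ col y × col y ≢ col z × col x ≢ col z

module NewColours
  {G : Set} {m k : ℕ} (c : G × Fin (suc m) → Fin k) (o : G) (α : Fin k) (cbar : G → Fin k)
  (new≤1 : ∀ g → ∣ colorsOnFiber c g ─ colorsOnFiber c o ∣ ≤ 1)
  (cbar-old : ∀ g → colorsOnFiber c g ⊆ colorsOnFiber c o → cbar g ≡ α)
  (cbar-new : ∀ g → ¬ (colorsOnFiber c g ⊆ colorsOnFiber c o)
                  → cbar g ∈ colorsOnFiber c g ─ colorsOnFiber c o)
  where

  private
    P : G → Subset k
    P = colorsOnFiber c

  cbar≢α⇒new : ∀ {g} → cbar g ≢ α → cbar g ∈ P g ─ P o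
  cbar≢α⇒new {g} cbar≢α = cbar-new g (λ P⊆Po → cbar≢α (cbar-old g P⊆Po))

  new-colour-unique : ∀ {g h z} → cbar g ≢ α → c (h , z) ≡ cbar g → cbar h ≡ cbar g
  new-colour-unique {g} {h} {z} cbar≢α chz≡cbar =
    ∣p∣≤1∧x∈p∧y∈p⇒x≡y (new≤1 h) (cbar-new h Ph⊈Po) (x∈p∧x∉q⇒x∈p─q ∈Ph ∉Po)
    where
    ∈Ph : cbar g ∈ P h
    ∈Ph = subst (_∈ P h) chz≡cbar (∈-colorsOnFiber⁺ c h z)
    ∉Po : cbar g ∉ P o
    ∉Po = x∈p─q⇒x∉q (cbar≢α⇒new cbar≢α)
    Ph⊈Po : ¬ (P h ⊆ P o)
    Ph⊈Po Ph⊆Po = ∉Po (Ph⊆Po ∈Ph)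

  ShowsNew : G → Fin (suc m) → Set
  ShowsNew g x = cbar g ≢ α × c (g , x) ≡ cbar g

  showsNew : ∀ {g} → cbar g ≢ α → ∃ (ShowsNew g)
  showsNew cbar≢α with ∈-colorsOnFiber⁻ c (p─q⊆p _ _ (cbar≢α⇒new cbar≢α))
  ... | x , cgx≡cbar = x , cbar≢α , cgx≡cbar

  showsNew-≢ˡ : ∀ {g h x z} → ShowsNew g x → cbar g ≢ cbar h → c (g , x) ≢ c (h , z)
  showsNew-≢ˡ (cbar≢α , cgx≡cbar) cbar≢ cgx≡chz =
    cbar≢ (sym (new-colour-unique cbar≢α (trans (sym cgx≡chz) cgx≡cbar)))

  showsNew-≢ʳ : ∀ {g h x z} → ShowsNew h z → cbar g ≢ cbar h → c (g , x) ≢ c (h , z)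
  showsNew-≢ʳ shown cbar≢ = ≢-sym (showsNew-≢ˡ shown (≢-sym cbar≢))

  module _ (_∙_ : G → G → G) where

    private
      Lifted : Set
      Lifted = HasRainbow3AP (prodOp _∙_ (suc m)) c

    lift-first-two : ∀ {a d} → Rainbow cbar a (a ∙ d) ((a ∙ d) ∙ d)
                     → cbar a ≢ α → cbar (a ∙ d) ≢ α → Lifted
    lift-first-two {a} {d} (ab , bc , ac) a-new b-new with showsNew a-new | showsNew b-new
    ... | x , a-shows | y , b-shows with ⊕-solveʳ x y
    ...   | e , refl =
      (a , x) , (d , e) , showsNew-≢ˡ a-shows ab , showsNew-≢ˡ b-shows bc , showsNew-≢ˡ a-shows ac

    lift-last-two : ∀ {a d} → Rainbow cbar a (a ∙ d) ((a ∙ d) ∙ d)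
                    → cbar (a ∙ d) ≢ α → cbar ((a ∙ d) ∙ d) ≢ α → Lifted
    lift-last-two {a} {d} (ab , bc , ac) b-new c-new with showsNew b-new | showsNew c-new
    ... | y , b-shows | z , c-shows with ap-with-last-two y z
    ...   | x , e , refl , refl =
      (a , x) , (d , e) , showsNew-≢ʳ b-shows ab , showsNew-≢ˡ b-shows bc , showsNew-≢ʳ c-shows ac

    lift-ends : ∀ s → s + s ≡ suc (suc m) → ∀ {a d} → Rainbow cbar a (a ∙ d) ((a ∙ d) ∙ d)
                → cbar a ≢ α → cbar ((a ∙ d) ∙ d) ≢ α → Lifted
    lift-ends s s+s≡n+1 {a} {d} (ab , bc , ac) a-new c-new with showsNew a-new | showsNew c-new
    ... | x , a-shows | z , c-shows with ap-with-ends s s+s≡n+1 x z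
    ...   | e , refl =
      (a , x) , (d , e) , showsNew-≢ˡ a-shows ab , showsNew-≢ʳ c-shows bc , showsNew-≢ˡ a-shows ac

    lift-rainbow : ∀ s → s + s ≡ suc (suc m) → HasRainbow3AP _∙_ cbar → Lifted
    lift-rainbow s s+s≡n+1 (a , d , rainbow@(ab , bc , ac)) with cbar a ≟ α | cbar (a ∙ d) ≟ α
    ... | no a-new  | no b-new  = lift-first-two rainbow a-new b-new
    ... | yes a-old | _         =
      lift-last-two rainbow (λ b-old → ab (trans a-old (sym b-old))) (λ c-old → ac (trans a-old (sym c-old)))
    ... | no a-new  | yes b-old =
      lift-ends s s+s≡n+1 rainbow a-new (λ c-old → bc (trans b-old (sym c-old)))

lemma7 : (G : Set) (_∙_ : G → G → G) (ε : G) (_⁻¹ : G → G)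
         → IsAbelianGroup _≡_ _∙_ ε _⁻¹
         → Σ ℕ (λ m → G ↔ Fin m)
         → (n : ℕ) → ∃ (λ t → n ≡ 1 + 2 * t)
         → (k : ℕ) (c : G × Fin n → Fin k)
         → (∀ g → ∣ colorsOnFiber c g ∣ ≤ ∣ colorsOnFiber c ε ∣)
         → (∀ g → ∣ colorsOnFiber c g ─ colorsOnFiber c ε ∣ ≤ 1)
         → (α : Fin k)
         → (∀ g → α ∉ (colorsOnFiber c g ─ colorsOnFiber c ε))
         → (cbar : G → Fin k)
         → (∀ g → colorsOnFiber c g ⊆ colorsOnFiber c ε → cbar g ≡ α)
         → (∀ g → ¬ (colorsOnFiber c g ⊆ colorsOnFiber c ε)
                → cbar g ∈ (colorsOnFiber c g ─ colorsOnFiber c ε))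
         → HasRainbow3AP _∙_ cbar
         → HasRainbow3AP (prodOp _∙_ n) c
lemma7 _ _∙_ ε _ _ _ .(1 + 2 * t) (t , refl) _ c _ new≤1 α _ cbar cbar-old cbar-new =
  NewColours.lift-rainbow c ε α cbar new≤1 cbar-old cbar-new _∙_ (suc t) (half t)
  where
  half : ∀ t → suc t + suc t ≡ suc (suc (2 * t))
  half = solve-∀
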